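{- $(21,1)\in\mathrm{HWP}(45;3,5)$; that is, $K_{45}$ has a 2-factorization consisting of exactly $21$ $C_3$-factors and $1$ $C_5$-factor.
   Context: A $C_k$-factor of a graph is a spanning subgraph all of whose components are cycles of length $k$. A 2-factorization is a partition of the edge set into 2-factors. $\mathrm{HWP}(v;m,n)$ is the set of pairs $(\alpha,\beta)$ such that $K_v$ ($v$ odd) or $K_v$ minus a 1-factor ($v$ even) has a 2-factorization into exactly $\alpha$ $C_m$-factors and $\beta$ $C_n$-factors. -}

module Defs where

open import Data.Nat using (ℕ; suc; _≤_)
open import Data.Nat.DivMod using (_mod_)
open import Data.Fin using (Fin; toℕ)
open import Data.Vec using (Vec; lookup)
open import Data.Product using (Σ; ∃; ∃!; _×_; _,_)
open import Data.Sum using (_⊎_)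
open import Relation.Binary.PropositionalEquality using (_≡_; _≢_)
open import Function.Definitions using (Bijective)

cycSucc : ∀ {k} → Fin k → Fin k
cycSucc {suc k} i = suc (toℕ i) mod suc k

-- A cycle of length k is written as a vertex sequence c = (c₀ … c_{k-1});
-- its edges are {c_i , c_{i+1 mod k}}.  (Distinctness of the vertices is
-- enforced in CkFactor below.)
-- x and y are adjacent in the cycle c:
AdjIn : ∀ {v k} → Vec (Fin v) k → Fin v → Fin v → Set
AdjIn {v} {k} c x y =
  ∃ λ (i : Fin k) →
    (lookup c i ≡ x × lookup c (cycSucc i) ≡ y)
    ⊎ (lookup c i ≡ y × lookup c (cycSucc i) ≡ x)

-- A C_k-factor of K_v (vertex set Fin v): a spanning subgraph whose
-- components are cycles of length k (k ≥ 3), given as m vertex-disjoint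
-- k-cycles covering every vertex exactly once.  Covering exactly once is
-- expressed as: (j , i) ↦ (i-th vertex of the j-th cycle) is a bijection
-- Fin m × Fin k → Fin v (this also gives distinct vertices in each cycle).
record CkFactor (v k : ℕ) : Set where
  field
    3≤k      : 3 ≤ k
    m        : ℕ
    cycles   : Fin m → Vec (Fin v) k
    partition : Bijective _≡_ _≡_ (λ (p : Fin m × Fin k) → lookup (cycles (Data.Product.proj₁ p)) (Data.Product.proj₂ p))

EdgeOf : ∀ {v k} → CkFactor v k → Fin v → Fin v → Set
EdgeOf F x y = ∃ λ j → AdjIn (CkFactor.cycles F j) x y

factorEdge : ∀ {v m n α β} → (Fin α → CkFactor v m) → (Fin β → CkFactor v n)
           → Fin α ⊎ Fin β → Fin v → Fin v → Set
factorEdge F G (Data.Sum.inj₁ a) x y = EdgeOf (F a) x y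
factorEdge F G (Data.Sum.inj₂ b) x y = EdgeOf (G b) x y

record TwoFactorization (v m n α β : ℕ) : Set where
  field
    mFactors : Fin α → CkFactor v m
    nFactors : Fin β → CkFactor v n
    edgePartition : ∀ (x y : Fin v) → x ≢ y
                  → ∃! _≡_ (λ t → factorEdge mFactors nFactors t x y)

-- Regard the vertices as ℤ₃ × ℤ₁₅, three copies of ℤ₁₅ acted on by translation.
-- The triangle factors are the 15 translates of one base factor together with
-- 3 translates each of two base factors that are invariant under translation by
-- 3; the pentagon factor consists of the cosets of 3ℤ₁₅ in each copy, traversed
-- in steps of 3.  What is left is finite and is certified by evaluation: a factor
-- partitions the vertex set once its position map has a partial inverse, and the
-- edge partition follows from a table recording every edge of every factor, in
-- both orientations, under that factor.  If every pair of distinct vertices is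
-- joined by the slot recorded in its cell and every factor edge finds its own
-- factor there, then two factors sharing an edge own the same cell, so coincide.

module Submission where

open import Data.Fin using (Fin; toℕ; combine; remQuot; splitAt; _≟_)
open import Data.Fin.Properties using (all?)
open import Data.List as List
  using (List; foldr; concatMap; cartesianProduct; cartesianProductWith; allFin; _++_)
open import Data.Maybe using (Maybe; just; nothing)
import Data.Maybe.Properties as Maybe
open import Data.Maybe.Relation.Unary.Any as Any using (Any; just; satisfied; drop-just)
open import Data.Nat using (ℕ; _+_; _*_; _≤_)
open import Data.Nat.DivMod using (_mod_)
open import Data.Nat.Properties using (≤-refl; m≤m+n)
open import Data.Product using (Σ-syntax; ∃₂; ∃!; _×_; _,_; proj₁; proj₂; uncurry)
import Data.Product.Properties as Product
open import Data.Sum using (_⊎_; inj₁; inj₂; [_,_])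
import Data.Sum.Properties as Sum
open import Data.Vec
  using (Vec; []; _∷_; lookup; map; tabulate; replicate; _[_]≔_; _[_]%=_)
open import Function using (_∘_)
open import Function.Definitions using (Injective; Bijective)
open import Function.Consequences.Propositional using (strictlySurjective⇒surjective)
open import Relation.Binary.PropositionalEquality using (_≡_; _≢_; refl; sym; trans; cong)
open import Relation.Nullary using (Dec)
open import Relation.Nullary.Decidable
  using (map′; _×-dec_; _⊎-dec_; _→-dec_; ¬?; from-yes)

open import Defs

module _ {A B : Set} (f : A → B) (g : B → Maybe A) where

  partialInverse⇒bijective : (∀ x → g (f x) ≡ just x) → (∀ y → Any (λ x → f x ≡ y) (g y))
                           → Bijective _≡_ _≡_ f
  partialInverse⇒bijective g∘f≡just hits =
    injective , strictlySurjective⇒surjective (satisfied ∘ hits)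
    where
    injective : Injective _≡_ _≡_ f
    injective {x} {x′} fx≡fx′ = Maybe.just-injective
      (trans (sym (g∘f≡just x)) (trans (cong g fx≡fx′) (g∘f≡just x′)))

module _ {v m k : ℕ} (cycles : Fin m → Vec (Fin v) k) where

  position : Fin m × Fin k → Fin v
  position (j , i) = lookup (cycles j) i

  positionTable : Vec (Maybe (Fin m × Fin k)) v
  positionTable = foldr (λ p table → table [ position p ]≔ just p) (replicate v nothing)
                        (cartesianProduct (allFin m) (allFin k))

  IsPositionTable : Vec (Maybe (Fin m × Fin k)) v → Set
  IsPositionTable table = (∀ j i → lookup table (position (j , i)) ≡ just (j , i))
                        × (∀ y → Any (λ p → position p ≡ y) (lookup table y))

  isPositionTable? : ∀ table → Dec (IsPositionTable table)
  isPositionTable? table =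
    (all? λ j → all? λ i →
       Maybe.≡-dec (Product.≡-dec _≟_ _≟_) (lookup table (position (j , i))) (just (j , i)))
    ×-dec (all? λ y → Any.dec (λ p → position p ≟ y) (lookup table y))

  cycleFactor : 3 ≤ k → IsPositionTable positionTable → CkFactor v k
  cycleFactor 3≤k (inverse , hits) = record
    { 3≤k       = 3≤k
    ; m         = m
    ; cycles    = cycles
    ; partition = partialInverse⇒bijective position (lookup positionTable) (uncurry inverse) hits
    }

module EdgeTable {v m n α β : ℕ} (F : Fin α → CkFactor v m) (G : Fin β → CkFactor v n) where

  Index : Set
  Index = Fin α ⊎ Fin β

  cycleLength cycleCount : Index → ℕ
  cycleLength (inj₁ _) = m
  cycleLength (inj₂ _) = n
  cycleCount (inj₁ a) = CkFactor.m (F a)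
  cycleCount (inj₂ b) = CkFactor.m (G b)

  cycle : (t : Index) → Fin (cycleCount t) → Vec (Fin v) (cycleLength t)
  cycle (inj₁ a) = CkFactor.cycles (F a)
  cycle (inj₂ b) = CkFactor.cycles (G b)

  Slot : Set
  Slot = Σ[ t ∈ Index ] Fin (cycleCount t) × Fin (cycleLength t)

  source target : Slot → Fin v
  source (t , j , i) = lookup (cycle t j) i
  target (t , j , i) = lookup (cycle t j) (cycSucc i)

  Joins : Slot → Fin v → Fin v → Set
  Joins s x y = (source s ≡ x × target s ≡ y) ⊎ (source s ≡ y × target s ≡ x)

  joins? : ∀ s x y → Dec (Joins s x y)
  joins? s x y = (source s ≟ x ×-dec target s ≟ y) ⊎-dec (source s ≟ y ×-dec target s ≟ x)

  joins⇒factorEdge : ∀ s {x y} → Joins s x y → factorEdge F G (proj₁ s) x y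
  joins⇒factorEdge (inj₁ a , j , i) joins = j , i , joins
  joins⇒factorEdge (inj₂ b , j , i) joins = j , i , joins

  factorEdge⇒joins : ∀ t {x y} → factorEdge F G t x y → ∃₂ λ j i → Joins (t , j , i) x y
  factorEdge⇒joins (inj₁ a) edge = edge
  factorEdge⇒joins (inj₂ b) edge = edge

  Owner : Index → Slot → Set
  Owner t s = proj₁ s ≡ t

  uniqueOwner : ∀ {x y} {e : Maybe Slot} → Any (λ s → Joins s x y) e
              → (∀ t → factorEdge F G t x y → Any (Owner t) e)
              → ∃! _≡_ (λ t → factorEdge F G t x y)
  uniqueOwner (just {s} joins) owned =
    proj₁ s , joins⇒factorEdge s joins , λ {t} edge → drop-just (owned t edge)

  Table : Set
  Table = Vec (Vec (Maybe Slot) v) v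

  entry : Table → Fin v → Fin v → Maybe Slot
  entry table x y = lookup (lookup table x) y

  Covers : Table → Set
  Covers table = ∀ x y → x ≢ y → Any (λ s → Joins s x y) (entry table x y)

  Consistent : Table → Set
  Consistent table = ∀ t j i → let s = (t , j , i) in
      Any (Owner t) (entry table (source s) (target s))
    × Any (Owner t) (entry table (target s) (source s))

  consistent⇒owner : ∀ {table} → Consistent table
                   → ∀ t {x y} → factorEdge F G t x y → Any (Owner t) (entry table x y)
  consistent⇒owner consistent t edge with factorEdge⇒joins t edge
  ... | j , i , inj₁ (refl , refl) = proj₁ (consistent t j i)
  ... | j , i , inj₂ (refl , refl) = proj₂ (consistent t j i)

  fromEdgeTable : ∀ table → Covers table → Consistent table → TwoFactorization v m n α β
  fromEdgeTable table covers consistent = record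
    { mFactors      = F
    ; nFactors      = G
    ; edgePartition = λ x y x≢y →
        uniqueOwner (covers x y x≢y) (λ t → consistent⇒owner {table} consistent t)
    }

  edgeTable : Table
  edgeTable = foldr insert (replicate v (replicate v nothing)) slots
    where
    slots : List Slot
    slots = concatMap (λ t → cartesianProductWith (λ j i → t , j , i) (allFin _) (allFin _))
                      (List.map inj₁ (allFin α) ++ List.map inj₂ (allFin β))
    insert : Slot → Table → Table
    insert s table = (table [ source s ]%= (_[ target s ]≔ just s))
                            [ target s ]%= (_[ source s ]≔ just s)

  covers? : ∀ table → Dec (Covers table)
  covers? table = all? λ x → all? λ y →
    ¬? (x ≟ y) →-dec Any.dec (λ s → joins? s x y) (entry table x y)

  consistent? : ∀ table → Dec (Consistent table)
  consistent? table = allIndices? λ t → all? λ j → all? λ i → owned? t _ ×-dec owned? t _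
    where
    owned? : ∀ t e → Dec (Any (Owner t) e)
    owned? t = Any.dec (λ s → Sum.≡-dec _≟_ _≟_ (proj₁ s) t)
    allIndices? : {P : Index → Set} → (∀ t → Dec (P t)) → Dec (∀ t → P t)
    allIndices? P? = map′ (λ (f , g) → [ f , g ]) (λ h → h ∘ inj₁ , h ∘ inj₂)
                          (all? (P? ∘ inj₁) ×-dec all? (P? ∘ inj₂))

-- (r , i) stands for the point i of the r-th copy of ℤ₁₅.
Point : Set
Point = ℕ × ℕ

vertex : Point → Fin 45
vertex (r , i) = combine (r mod 3) (i mod 15)

translate : ℕ → Point → Point
translate d (r , i) = r , i + d

-- Factor d of a family of c factors: the base cycles translated by d + c s for s < n.
development : ∀ {b k} (n c d : ℕ) → Vec (Vec Point k) b → Fin (b * n) → Vec (Fin 45) k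
development n c d base =
  uncurry (λ j s → map (vertex ∘ translate (d + c * toℕ s)) (lookup base j)) ∘ remQuot n

baseTriangles₀ : Vec (Vec Point 3) 15
baseTriangles₀ =
    ((0 , 1) ∷ (0 , 5) ∷ (1 , 5) ∷ [])
  ∷ ((0 , 0) ∷ (0 , 2) ∷ (2 , 9) ∷ [])
  ∷ ((0 , 6) ∷ (0 , 14) ∷ (1 , 9) ∷ [])
  ∷ ((0 , 10) ∷ (0 , 11) ∷ (1 , 4) ∷ [])
  ∷ ((0 , 4) ∷ (0 , 13) ∷ (1 , 0) ∷ [])
  ∷ ((0 , 9) ∷ (1 , 6) ∷ (2 , 11) ∷ [])
  ∷ ((0 , 12) ∷ (2 , 3) ∷ (2 , 12) ∷ [])
  ∷ ((0 , 8) ∷ (2 , 1) ∷ (2 , 5) ∷ [])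
  ∷ ((0 , 7) ∷ (2 , 6) ∷ (2 , 8) ∷ [])
  ∷ ((0 , 3) ∷ (1 , 2) ∷ (2 , 13) ∷ [])
  ∷ ((1 , 1) ∷ (1 , 7) ∷ (2 , 4) ∷ [])
  ∷ ((1 , 10) ∷ (1 , 14) ∷ (2 , 14) ∷ [])
  ∷ ((1 , 12) ∷ (1 , 13) ∷ (2 , 7) ∷ [])
  ∷ ((1 , 8) ∷ (2 , 0) ∷ (2 , 10) ∷ [])
  ∷ ((1 , 3) ∷ (1 , 11) ∷ (2 , 2) ∷ [])
  ∷ []

baseTriangles₁ : Vec (Vec Point 3) 3
baseTriangles₁ =
    ((1 , 6) ∷ (0 , 1) ∷ (1 , 8) ∷ [])
  ∷ ((2 , 4) ∷ (0 , 14) ∷ (2 , 3) ∷ [])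
  ∷ ((1 , 1) ∷ (0 , 3) ∷ (2 , 14) ∷ [])
  ∷ []

baseTriangles₂ : Vec (Vec Point 3) 3
baseTriangles₂ =
    ((1 , 13) ∷ (0 , 7) ∷ (1 , 8) ∷ [])
  ∷ ((1 , 3) ∷ (2 , 11) ∷ (2 , 4) ∷ [])
  ∷ ((2 , 12) ∷ (0 , 9) ∷ (0 , 14) ∷ [])
  ∷ []

basePentagons : Vec (Vec Point 5) 3
basePentagons = tabulate λ r → tabulate λ u → toℕ r , 3 * toℕ u

triangleCycles : Fin 21 → Fin 15 → Vec (Fin 45) 3
triangleCycles a with splitAt 15 a
... | inj₁ d = development 1 15 (toℕ d) baseTriangles₀
... | inj₂ e with splitAt 3 e
...   | inj₁ d = development 5 3 (toℕ d) baseTriangles₁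
...   | inj₂ d = development 5 3 (toℕ d) baseTriangles₂

pentagonCycles : Fin 9 → Vec (Fin 45) 5
pentagonCycles = development 3 1 0 basePentagons

triangleFactor : Fin 21 → CkFactor 45 3
triangleFactor a = cycleFactor (triangleCycles a) ≤-refl (valid a)
  where
  valid : ∀ b → IsPositionTable (triangleCycles b) (positionTable (triangleCycles b))
  valid = from-yes (all? λ b → isPositionTable? (triangleCycles b) (positionTable (triangleCycles b)))

pentagonFactor : Fin 1 → CkFactor 45 5
pentagonFactor _ = cycleFactor pentagonCycles (m≤m+n 3 2)
  (from-yes (isPositionTable? pentagonCycles (positionTable pentagonCycles)))

lemma4p1 : TwoFactorization 45 3 5 21 1
lemma4p1 =
  fromEdgeTable edgeTable (from-yes (covers? edgeTable)) (from-yes (consistent? edgeTable))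
  where open EdgeTable triangleFactor pentagonFactor
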